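{- Let $n\geq 3$ and let $(d_1,\dots,d_n)$ be a sequence of integers satisfying (i) $d_1\geq d_2\geq\cdots\geq d_n\geq 4$; (ii) $\sum_{i=1}^n d_i$ is even; (iii) $d_1\leq \sum_{i=2}^n (d_i-1)$. Then there exists a triangular multigraph $G$ on vertices $v_1,\dots,v_n$ with $\deg(v_i)=d_i$ for all $i\in\{1,\dots,n\}$.
   Context: A multigraph is a finite graph in which multiple edges between the same pair of vertices are allowed; the degree of a vertex is the number of edges incident to it, counted with multiplicity. A triangle in a multigraph consists of three distinct vertices which are pairwise adjacent. A multigraph is triangular if every edge is contained in a triangle. A sequence $(d_1,\dots,d_n)$ is the degree sequence of a multigraph if the multigraph has vertices $v_1,\dots,v_n$ with $\deg(v_i)=d_i$ for all $i$. -}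

module Defs where

open import Data.Nat using (ℕ; zero; suc; _+_; _∸_; _≤_; _<_; _≥_)
open import Data.Fin using (Fin; zero; suc; toℕ)
open import Data.Fin.Properties using ()
open import Data.Product using (Σ; ∃; _×_; _,_)
open import Relation.Binary.PropositionalEquality using (_≡_)

∑ : ∀ {n} → (Fin n → ℕ) → ℕ
∑ {zero}  f = 0
∑ {suc n} f = f zero + ∑ (λ i → f (suc i))

record Multigraph (n : ℕ) : Set where
  field
    mult      : Fin n → Fin n → ℕ
    symmetric : ∀ i j → mult i j ≡ mult j i
    loopless  : ∀ i → mult i i ≡ 0

open Multigraph public

Adjacent : ∀ {n} → Multigraph n → Fin n → Fin n → Set
Adjacent G i j = 0 < mult G i j

deg : ∀ {n} → Multigraph n → Fin n → ℕ
deg G i = ∑ (λ j → mult G i j)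

-- Every edge lies in a triangle: for adjacent i j there is k adjacent to both.
-- (Since the multigraph is loopless, adjacency forces i, j, k pairwise distinct.)
Triangular : ∀ {n} → Multigraph n → Set
Triangular {n} G = ∀ i j → Adjacent G i j → ∃ λ (k : Fin n) → Adjacent G i k × Adjacent G j k

Even : ℕ → Set
Even m = ∃ λ k → m ≡ k + k

{-# OPTIONS --safe #-}
module Submission where

-- Let x have the largest degree h and let O be the
-- other m vertices.  If m ≤ h, join x to O by a windmill of triangles x a b (an odd tail
-- a b c gets the triangles x a b and x b c).  The remaining requests (h − m for x, d − 2 for
-- the others) have even sum and none exceeds half of it, so Hakimi's pairing realises them
-- by a loopless multigraph on x ∪ O.  Each of its edges lies in a triangle: an edge a b
-- through x, an edge x a through the windmill triangle at a.  If m > h, the hub is given only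
-- about h/3 partners (one more if parity demands it); the rest of the vertices still satisfy
-- the hypotheses, and the two realisations are put side by side.

open import Defs
open import Data.Nat using (ℕ; zero; suc; _+_; _*_; _∸_; _≥_; _≤_; _<_; z≤n; s≤s; z<s; _≤?_)
open import Data.Nat.Properties
open import Data.Nat.Solver using (module +-*-Solver)
open import Data.Fin using (Fin; zero; suc)
open import Data.Product using (Σ; ∃; _×_; _,_; proj₁; proj₂)
import Data.Product as Product
open import Data.Sum using (_⊎_; inj₁; inj₂)
open import Data.Empty using (⊥; ⊥-elim)
open import Data.List using (List; []; _∷_; _++_; map; length; take; drop; tabulate)
open import Data.Nat.ListAction using (sum)
import Data.Nat.ListAction.Properties as ListActionₚ
open import Data.List.Properties using (length-++; map-++; length-map; length-take; take++drop≡id; length-tabulate; map-tabulate)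
open import Data.List.Relation.Unary.All as All using (All; []; _∷_)
import Data.List.Relation.Unary.All.Properties as Allₚ
open import Data.List.Relation.Unary.Any using (here; there)
open import Data.List.Membership.Propositional using (_∈_)
import Data.List.Membership.Propositional.Properties as ∈ₚ
open import Data.List.Relation.Unary.AllPairs as AllPairs using ([]; _∷_)
open import Data.List.Relation.Unary.Unique.Propositional using (Unique)
import Data.List.Relation.Unary.Unique.Propositional.Properties as Uniqueₚ
open import Data.List.Relation.Binary.Permutation.Propositional using (_↭_; ↭-refl; ↭-sym; ↭-trans; prep; swap; ↭⇒↭ₛ)
import Data.List.Relation.Binary.Permutation.Propositional.Properties as ↭ₚ
import Data.List.Relation.Binary.Permutation.Setoid.Properties as ↭ₛₚ
open import Relation.Nullary using (yes; no)
open import Relation.Binary.PropositionalEquality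
  using (_≡_; _≢_; refl; sym; trans; cong; cong₂; subst; subst₂; setoid; module ≡-Reasoning)

open +-*-Solver using (solve; _:=_; _:+_; _:*_; con)

δ : ∀ {n} → Fin n → Fin n → ℕ
δ zero    zero    = 1
δ zero    (suc _) = 0
δ (suc _) zero    = 0
δ (suc i) (suc j) = δ i j

δ-refl : ∀ {n} (i : Fin n) → δ i i ≡ 1
δ-refl zero    = refl
δ-refl (suc i) = δ-refl i

δ-pos⇒≡ : ∀ {n} {i j : Fin n} → 0 < δ i j → i ≡ j
δ-pos⇒≡ {i = zero}  {zero}  _ = refl
δ-pos⇒≡ {i = suc i} {suc j} p = cong suc (δ-pos⇒≡ p)

m*n>0⇒m>0×n>0 : ∀ m n → 0 < m * n → 0 < m × 0 < n
m*n>0⇒m>0×n>0 (suc m) (suc n) _ = z<s , z<s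
m*n>0⇒m>0×n>0 (suc m) zero    p = ⊥-elim (<-irrefl refl (subst (0 <_) (*-zeroʳ (suc m)) p))

δ*δ-pos⇒≡ : ∀ {n} {i u j v : Fin n} → 0 < δ i u * δ j v → i ≡ u × j ≡ v
δ*δ-pos⇒≡ p = Product.map δ-pos⇒≡ δ-pos⇒≡ (m*n>0⇒m>0×n>0 _ _ p)

∑-+ : ∀ {n} (f g : Fin n → ℕ) → ∑ (λ i → f i + g i) ≡ ∑ f + ∑ g
∑-+ {zero}  f g = refl
∑-+ {suc n} f g =
  trans (cong (f zero + g zero +_) (∑-+ (λ i → f (suc i)) (λ i → g (suc i))))
        (solve 4 (λ a b F G → a :+ b :+ (F :+ G) := a :+ F :+ (b :+ G)) refl (f zero) (g zero) _ _)

∑-* : ∀ {n} (c : ℕ) (f : Fin n → ℕ) → ∑ (λ i → c * f i) ≡ c * ∑ f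
∑-* {zero}  c f = sym (*-zeroʳ c)
∑-* {suc n} c f = trans (cong (c * f zero +_) (∑-* c (λ i → f (suc i))))
                        (sym (*-distribˡ-+ c (f zero) _))

∑-zero : ∀ {n} → ∑ {n} (λ _ → 0) ≡ 0
∑-zero {zero}  = refl
∑-zero {suc n} = ∑-zero {n}

∑-δ : ∀ {n} (v : Fin n) → ∑ (λ j → δ j v) ≡ 1
∑-δ {suc n} zero    = cong suc (∑-zero {n})
∑-δ {suc n} (suc v) = ∑-δ v

∑-*δ : ∀ {n} (c : ℕ) (v : Fin n) → ∑ (λ j → c * δ j v) ≡ c
∑-*δ c v = trans (∑-* c (λ j → δ j v)) (trans (cong (c *_) (∑-δ v)) (*-identityʳ c))

∑-∸1 : ∀ {m} (f : Fin m → ℕ) → (∀ i → 1 ≤ f i) → ∑ (λ i → f i ∸ 1) + m ≡ ∑ f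
∑-∸1 {zero}  f pos = refl
∑-∸1 {suc m} f pos = begin
  (f zero ∸ 1) + ∑ (λ i → f (suc i) ∸ 1) + suc m
    ≡⟨ +-suc _ m ⟩
  suc ((f zero ∸ 1) + ∑ (λ i → f (suc i) ∸ 1) + m)
    ≡⟨ cong suc (+-assoc (f zero ∸ 1) _ m) ⟩
  suc ((f zero ∸ 1) + (∑ (λ i → f (suc i) ∸ 1) + m))
    ≡⟨ cong (λ t → suc ((f zero ∸ 1) + t)) (∑-∸1 (λ i → f (suc i)) (λ i → pos (suc i))) ⟩
  suc (f zero ∸ 1) + ∑ (λ i → f (suc i))
    ≡⟨ cong (_+ ∑ (λ i → f (suc i))) (trans (+-comm 1 _) (m∸n+n≡m (pos zero))) ⟩
  ∑ f ∎
  where open ≡-Reasoning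

∑-δ* : ∀ {n} (z : Fin n) (f : Fin n → ℕ) → ∑ (λ i → δ z i * f i) ≡ f z
∑-δ* {suc n} zero    f = trans (cong₂ _+_ (+-identityʳ (f zero)) (∑-zero {n})) (+-identityʳ (f zero))
∑-δ*         (suc z) f = ∑-δ* z (λ i → f (suc i))

sum-tabulate : ∀ {n} (f : Fin n → ℕ) → sum (tabulate f) ≡ ∑ f
sum-tabulate {zero}  f = refl
sum-tabulate {suc n} f = cong (f zero +_) (sum-tabulate (λ i → f (suc i)))

Edge : ℕ → Set
Edge n = Fin n × Fin n

NonLoop : ∀ {n} → Edge n → Set
NonLoop (u , v) = u ≢ v

edgeDegree : ∀ {n} → List (Edge n) → Fin n → ℕ
edgeDegree E z = sum (map (λ e → δ z (proj₁ e) + δ z (proj₂ e)) E)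

multiplicity : ∀ {n} → List (Edge n) → Fin n → Fin n → ℕ
multiplicity []            i j = 0
multiplicity ((u , v) ∷ E) i j = δ i u * δ j v + δ i v * δ j u + multiplicity E i j

Joined : ∀ {n} → List (Edge n) → Fin n → Fin n → Set
Joined E a b = (a , b) ∈ E ⊎ (b , a) ∈ E

InTriangle : ∀ {n} → List (Edge n) → Edge n → Set
InTriangle E (u , v) = u ≢ v × ∃ λ k → Joined E u k × Joined E v k

Triangulated : ∀ {n} → List (Edge n) → Set
Triangulated E = All (InTriangle E) E

Joined-sym : ∀ {n} {E : List (Edge n)} {a b} → Joined E a b → Joined E b a
Joined-sym (inj₁ ab) = inj₂ ab
Joined-sym (inj₂ ba) = inj₁ ba

Joined-∷ : ∀ {n} {E : List (Edge n)} {e a b} → Joined E a b → Joined (e ∷ E) a b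
Joined-∷ (inj₁ ab) = inj₁ (there ab)
Joined-∷ (inj₂ ba) = inj₂ (there ba)

multiplicity-sym : ∀ {n} (E : List (Edge n)) i j → multiplicity E i j ≡ multiplicity E j i
multiplicity-sym []            i j = refl
multiplicity-sym ((u , v) ∷ E) i j =
  cong₂ _+_ (trans (+-comm (δ i u * δ j v) _) (cong₂ _+_ (*-comm (δ i v) _) (*-comm (δ i u) _)))
            (multiplicity-sym E i j)

∑-multiplicity : ∀ {n} (E : List (Edge n)) i → ∑ (multiplicity E i) ≡ edgeDegree E i
∑-multiplicity {n} []            i = ∑-zero {n}
∑-multiplicity ((u , v) ∷ E) i = begin
  ∑ (λ j → δ i u * δ j v + δ i v * δ j u + multiplicity E i j)
    ≡⟨ ∑-+ _ (multiplicity E i) ⟩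
  ∑ (λ j → δ i u * δ j v + δ i v * δ j u) + ∑ (multiplicity E i)
    ≡⟨ cong₂ _+_ (∑-+ (λ j → δ i u * δ j v) (λ j → δ i v * δ j u)) (∑-multiplicity E i) ⟩
  ∑ (λ j → δ i u * δ j v) + ∑ (λ j → δ i v * δ j u) + edgeDegree E i
    ≡⟨ cong (_+ edgeDegree E i) (cong₂ _+_ (∑-*δ (δ i u) v) (∑-*δ (δ i v) u)) ⟩
  δ i u + δ i v + edgeDegree E i ∎
  where open ≡-Reasoning

m+n>0⇒m>0⊎n>0 : ∀ m n → 0 < m + n → 0 < m ⊎ 0 < n
m+n>0⇒m>0⊎n>0 zero    n p = inj₂ p
m+n>0⇒m>0⊎n>0 (suc m) n p = inj₁ z<s

multiplicity-pos⇒Joined : ∀ {n} (E : List (Edge n)) {i j} → 0 < multiplicity E i j → Joined E i j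
multiplicity-pos⇒Joined ((u , v) ∷ E) {i} {j} p
  with m+n>0⇒m>0⊎n>0 (δ i u * δ j v + δ i v * δ j u) _ p
... | inj₂ q = Joined-∷ (multiplicity-pos⇒Joined E q)
... | inj₁ q with m+n>0⇒m>0⊎n>0 (δ i u * δ j v) _ q
...   | inj₁ r with δ*δ-pos⇒≡ {i = i} {u} {j} {v} r
...     | refl , refl = inj₁ (here refl)
multiplicity-pos⇒Joined ((u , v) ∷ E) {i} {j} p
      | inj₁ q | inj₂ r with δ*δ-pos⇒≡ {i = i} {v} {j} {u} r
...     | refl , refl = inj₂ (here refl)

∈⇒multiplicity-pos : ∀ {n} {E : List (Edge n)} {i j} → (i , j) ∈ E → 0 < multiplicity E i j
∈⇒multiplicity-pos {i = i} {j} (here refl) rewrite δ-refl i | δ-refl j = z<s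
∈⇒multiplicity-pos             (there ij)  = <-≤-trans (∈⇒multiplicity-pos ij) (m≤n+m _ _)

Joined⇒multiplicity-pos : ∀ {n} {E : List (Edge n)} {i j} → Joined E i j → 0 < multiplicity E i j
Joined⇒multiplicity-pos         (inj₁ ij) = ∈⇒multiplicity-pos ij
Joined⇒multiplicity-pos {E = E} (inj₂ ji) = subst (0 <_) (multiplicity-sym E _ _) (∈⇒multiplicity-pos ji)

multiplicity-loop : ∀ {n} {E : List (Edge n)} → All NonLoop E → ∀ i → multiplicity E i i ≡ 0
multiplicity-loop {E = E} nonLoop i = n≤0⇒n≡0 (≮⇒≥ (λ p → loop (multiplicity-pos⇒Joined E p)))
  where
  loop : Joined E i i → ⊥
  loop (inj₁ ii) = All.lookup nonLoop ii refl
  loop (inj₂ ii) = All.lookup nonLoop ii refl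

toMultigraph : ∀ {n} (E : List (Edge n)) → All NonLoop E → Multigraph n
toMultigraph E nonLoop = record
  { mult      = multiplicity E
  ; symmetric = multiplicity-sym E
  ; loopless  = multiplicity-loop nonLoop
  }

toMultigraph-triangular : ∀ {n} (E : List (Edge n)) (t : Triangulated E) →
                          Triangular (toMultigraph E (All.map proj₁ t))
toMultigraph-triangular E t i j p with multiplicity-pos⇒Joined E p
... | inj₁ ij with All.lookup t ij
...   | _ , k , ik , jk = k , Joined⇒multiplicity-pos ik , Joined⇒multiplicity-pos jk
toMultigraph-triangular E t i j p | inj₂ ji with All.lookup t ji
...   | _ , k , jk , ik = k , Joined⇒multiplicity-pos ik , Joined⇒multiplicity-pos jk

Request : ℕ → Set
Request n = Fin n × ℕ

demand : ∀ {n} → List (Request n) → Fin n → ℕ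
demand L z = sum (map (λ e → δ z (proj₁ e) * proj₂ e) L)

total : ∀ {n} → List (Request n) → ℕ
total L = sum (map proj₂ L)

vertices : ∀ {n} → List (Request n) → List (Fin n)
vertices = map proj₁

Realization : ∀ {n} → List (Request n) → Set
Realization {n} L = Σ (List (Edge n)) λ E → Triangulated E × (∀ z → edgeDegree E z ≡ demand L z)

sum-map-++ : ∀ {A : Set} (f : A → ℕ) xs ys → sum (map f (xs ++ ys)) ≡ sum (map f xs) + sum (map f ys)
sum-map-++ f xs ys = trans (cong sum (map-++ f xs ys)) (ListActionₚ.sum-++ (map f xs) (map f ys))

sum-map-↭ : ∀ {A : Set} (f : A → ℕ) {xs ys} → xs ↭ ys → sum (map f xs) ≡ sum (map f ys)
sum-map-↭ f p = ListActionₚ.sum-↭ (↭ₚ.map⁺ f p)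

Unique-↭ : ∀ {A : Set} {xs ys : List A} → xs ↭ ys → Unique xs → Unique ys
Unique-↭ {A} p = ↭ₛₚ.Unique-resp-↭ (setoid A) (↭⇒↭ₛ p)

Unique-++⁻ : ∀ {A : Set} (xs : List A) {ys} → Unique (xs ++ ys) → Unique xs × Unique ys
Unique-++⁻ []       u          = [] , u
Unique-++⁻ (x ∷ xs) (x∉ ∷ u) = Product.map₁ (Allₚ.++⁻ˡ xs x∉ ∷_) (Unique-++⁻ xs u)

Joined-++⁺ˡ : ∀ {n} {E : List (Edge n)} F {a b} → Joined E a b → Joined (E ++ F) a b
Joined-++⁺ˡ F (inj₁ ab) = inj₁ (∈ₚ.∈-++⁺ˡ ab)
Joined-++⁺ˡ F (inj₂ ba) = inj₂ (∈ₚ.∈-++⁺ˡ ba)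

Joined-++⁺ʳ : ∀ {n} E {F : List (Edge n)} {a b} → Joined F a b → Joined (E ++ F) a b
Joined-++⁺ʳ E (inj₁ ab) = inj₁ (∈ₚ.∈-++⁺ʳ E ab)
Joined-++⁺ʳ E (inj₂ ba) = inj₂ (∈ₚ.∈-++⁺ʳ E ba)

Triangulated-++ : ∀ {n} {E F : List (Edge n)} → Triangulated E → Triangulated F → Triangulated (E ++ F)
Triangulated-++ {E = E} {F} tE tF = Allₚ.++⁺ (All.map inˡ tE) (All.map inʳ tF)
  where
  inˡ : ∀ {e} → InTriangle E e → InTriangle (E ++ F) e
  inˡ (u≢v , k , uk , vk) = u≢v , k , Joined-++⁺ˡ F uk , Joined-++⁺ˡ F vk
  inʳ : ∀ {e} → InTriangle F e → InTriangle (E ++ F) e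
  inʳ (u≢v , k , uk , vk) = u≢v , k , Joined-++⁺ʳ E uk , Joined-++⁺ʳ E vk

realization-++ : ∀ {n} {A B : List (Request n)} → Realization A → Realization B → Realization (A ++ B)
realization-++ {A = A} {B} (E , tE , dE) (F , tF , dF) = E ++ F , Triangulated-++ tE tF , degrees
  where
  degrees : ∀ z → edgeDegree (E ++ F) z ≡ demand (A ++ B) z
  degrees z = begin
    edgeDegree (E ++ F) z          ≡⟨ sum-map-++ _ E F ⟩
    edgeDegree E z + edgeDegree F z ≡⟨ cong₂ _+_ (dE z) (dF z) ⟩
    demand A z + demand B z         ≡⟨ sum-map-++ _ A B ⟨
    demand (A ++ B) z               ∎
    where open ≡-Reasoning

realization-↭ : ∀ {n} {A B : List (Request n)} → A ↭ B → Realization B → Realization A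
realization-↭ A↭B (E , t , d) = E , t , λ z → trans (d z) (sum-map-↭ _ (↭-sym A↭B))

Odd : ℕ → Set
Odd m = ∃ λ k → m ≡ suc (k + k)

even⊎odd : ∀ m → Even m ⊎ Odd m
even⊎odd zero    = inj₁ (0 , refl)
even⊎odd (suc m) with even⊎odd m
... | inj₁ (k , m≡k+k)  = inj₂ (k , cong suc m≡k+k)
... | inj₂ (k , m≡1+2k) = inj₁ (suc k , cong suc (trans m≡1+2k (sym (+-suc k k))))

even⇒¬odd : ∀ {m} → Even m → Odd m → ⊥
even⇒¬odd (k , refl) (j , e) = k+k≢1+j+j k j e
  where
  k+k≢1+j+j : ∀ k j → k + k ≢ suc (j + j)
  k+k≢1+j+j (suc k) zero    e = 0≢1+n (sym (trans (sym (+-suc k k)) (suc-injective e)))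
  k+k≢1+j+j (suc k) (suc j) e =
    k+k≢1+j+j k j (suc-injective (trans (sym (+-suc k k)) (trans (suc-injective e) (cong suc (+-suc j j)))))

even+even : ∀ {a b} → Even a → Even b → Even (a + b)
even+even (k , refl) (j , refl) = k + j , solve 2 (λ k j → (k :+ k) :+ (j :+ j) := (k :+ j) :+ (k :+ j)) refl k j

odd+odd : ∀ {a b} → Odd a → Odd b → Even (a + b)
odd+odd (k , refl) (j , refl) =
  suc (k + j) , solve 2 (λ k j → (con 1 :+ (k :+ k)) :+ (con 1 :+ (j :+ j)) := (con 1 :+ (k :+ j)) :+ (con 1 :+ (k :+ j))) refl k j

even+odd : ∀ {a b} → Even a → Odd b → Odd (a + b)
even+odd (k , refl) (j , refl) =
  k + j , solve 2 (λ k j → (k :+ k) :+ (con 1 :+ (j :+ j)) := con 1 :+ ((k :+ j) :+ (k :+ j))) refl k j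

even-+⁻ʳ : ∀ {a b} → Even (a + b) → Even a → Even b
even-+⁻ʳ {a} {b} a+b a-even with even⊎odd b
... | inj₁ b-even = b-even
... | inj₂ b-odd  = ⊥-elim (even⇒¬odd a+b (even+odd a-even b-odd))

odd-+⁻ʳ : ∀ {a b} → Even (a + b) → Odd a → Odd b
odd-+⁻ʳ {a} {b} a+b a-odd with even⊎odd b
... | inj₂ b-odd  = b-odd
... | inj₁ b-even = ⊥-elim (even⇒¬odd a+b (subst Odd (+-comm b a) (even+odd b-even a-odd)))

cancel-≤ : ∀ {A B} c d X → A ≤ B → A ≡ c + X → B ≡ d + X → c ≤ d
cancel-≤ c d X A≤B refl refl = +-cancelʳ-≤ X c d A≤B

even-pos⇒≥2 : ∀ {s} → Even s → 1 ≤ s → 2 ≤ s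
even-pos⇒≥2 (suc k , refl) _ = s≤s (subst (1 ≤_) (sym (+-suc k k)) z<s)

∈⇒≤total : ∀ {n} {e : Request n} {L} → e ∈ L → proj₂ e ≤ total L
∈⇒≤total {L = (y , r) ∷ L} (here refl) = m≤m+n r _
∈⇒≤total {L = (y , r) ∷ L} (there e∈L) = ≤-trans (∈⇒≤total e∈L) (m≤n+m _ r)

all≤0⇒total≡0 : ∀ {n} (L : List (Request n)) → All (λ f → proj₂ f ≤ 0) L → total L ≡ 0
all≤0⇒total≡0 []            []          = refl
all≤0⇒total≡0 ((y , 0) ∷ L) (z≤n ∷ L≤0) = all≤0⇒total≡0 L L≤0

total≡0⇒demand≡0 : ∀ {n} (L : List (Request n)) → total L ≡ 0 → ∀ z → demand L z ≡ 0
total≡0⇒demand≡0 []            _ z = refl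
total≡0⇒demand≡0 ((y , r) ∷ L) t z rewrite m+n≡0⇒m≡0 r t | *-zeroʳ (δ z y) =
  total≡0⇒demand≡0 L (m+n≡0⇒n≡0 r t) z

extract-max : ∀ {n} (e : Request n) L →
  ∃ λ e′ → ∃ λ O → (e ∷ L ↭ e′ ∷ O) × All (λ f → proj₂ f ≤ proj₂ e′) O
extract-max e [] = e , [] , ↭-refl , []
extract-max e (f ∷ L) with extract-max f L
... | g , O , p , O≤g with proj₂ e ≤? proj₂ g
...   | yes e≤g = g , e ∷ O , ↭-trans (prep e p) (swap e g ↭-refl) , e≤g ∷ O≤g
...   | no  e≰g = e , g ∷ O , prep e p , g≤e ∷ All.map (λ f≤g → ≤-trans f≤g g≤e) O≤g
  where
  g≤e : proj₂ g ≤ proj₂ e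
  g≤e = ≰⇒≥ e≰g

Within : ∀ {n} → List (Fin n) → Edge n → Set
Within N (u , v) = u ≢ v × u ∈ N × v ∈ N

Within-⊆ : ∀ {n} {N M : List (Fin n)} → (∀ {y} → y ∈ N → y ∈ M) → ∀ {e} → Within N e → Within M e
Within-⊆ N⊆M {u , v} (u≢v , u∈N , v∈N) = u≢v , N⊆M u∈N , N⊆M v∈N

Balanced : ∀ {n} → List (Request n) → Set
Balanced R = All (λ e → 2 * proj₂ e ≤ total R) R

LooplessRealization : ∀ {n} → List (Request n) → Set
LooplessRealization {n} R =
  Σ (List (Edge n)) λ F → All (Within (vertices R)) F × (∀ z → edgeDegree F z ≡ demand R z)

balanced-concentrated : ∀ {n} {R : List (Request n)} {x c O} → R ↭ (x , c) ∷ O →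
                        All (λ f → proj₂ f ≤ 0) O → Balanced R → total R ≡ 0
balanced-concentrated {R = R} {c = c} {O} p O≤0 bal = trans total≡c+0 c+0≡0
  where
  total≡c+0 : total R ≡ c + 0
  total≡c+0 = trans (sum-map-↭ proj₂ p) (cong (c +_) (all≤0⇒total≡0 O O≤0))
  c+0≡0 : c + 0 ≡ 0
  c+0≡0 = n≤0⇒n≡0 (+-cancelˡ-≤ c (c + 0) 0 (subst (2 * c ≤_) total≡c+0 (All.head (↭ₚ.All-resp-↭ p bal))))

record TopTwo {n} (R : List (Request n)) : Set where
  constructor topTwo
  field
    x y  : Fin n
    a b  : ℕ
    rest : List (Request n)
    perm : R ↭ (x , suc a) ∷ (y , suc b) ∷ rest
    b≤a  : b ≤ a
    rest≤ : All (λ f → proj₂ f ≤ suc b) rest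

top-two : ∀ {n} (R : List (Request n)) → 0 < total R → Balanced R → TopTwo R
top-two (e ∷ L) pos bal with extract-max e L
... | (x , zero) , O , p , O≤0 = ⊥-elim (<-irrefl (sym (balanced-concentrated p O≤0 bal)) pos)
... | (x , suc a) , [] , p , _ = ⊥-elim (<-irrefl (sym (balanced-concentrated p [] bal)) pos)
... | (x , suc a) , f ∷ O , p , O≤1+a with extract-max f O
...   | (y , zero)  , R₂ , p₂ , R₂≤0 =
        ⊥-elim (<-irrefl (sym (balanced-concentrated p (↭ₚ.All-resp-↭ (↭-sym p₂) (z≤n ∷ R₂≤0)) bal)) pos)
...   | (y , suc b) , R₂ , p₂ , R₂≤1+b =
        topTwo x y a b R₂ (↭-trans p (prep _ p₂)) (≤-pred (All.head (↭ₚ.All-resp-↭ p₂ O≤1+a))) R₂≤1+b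

pairing-bound : ∀ a b s c → Even (a + (b + s)) → 2 * a ≤ a + (b + s) → b ≤ a → c ≤ suc b → c ≤ s →
                2 * c ≤ a + (b + s)
pairing-bound a b s c even 2a≤T b≤a c≤1+b c≤s with c ≤? a
... | yes c≤a = ≤-trans (*-monoʳ-≤ 2 c≤a) 2a≤T
... | no  c≰a with ≤-antisym (≤-trans c≤1+b (s≤s b≤a)) (≰⇒> c≰a)
                 | ≤-antisym b≤a (≤-pred (≤-trans (≰⇒> c≰a) c≤1+b))
...   | refl | refl = subst (_≤ a + (a + s)) (solve 1 (λ a → a :+ (a :+ con 2) := con 2 :* (con 1 :+ a)) refl a)
                        (+-monoʳ-≤ a (+-monoʳ-≤ a (2≤s a even c≤s)))
  where
  2≤s : ∀ a → Even (a + (a + s)) → suc a ≤ s → 2 ≤ s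
  2≤s zero    even 1≤s   = even-pos⇒≥2 even 1≤s
  2≤s (suc a) _    2+a≤s = ≤-trans (s≤s (s≤s z≤n)) 2+a≤s

balanced-after-pairing : ∀ {n} {x y : Fin n} {a b} R → b ≤ a → All (λ f → proj₂ f ≤ suc b) R →
  Even (total ((x , a) ∷ (y , b) ∷ R)) →
  Balanced ((x , suc a) ∷ (y , suc b) ∷ R) → Balanced ((x , a) ∷ (y , b) ∷ R)
balanced-after-pairing {a = a} {b} R b≤a R≤1+b even (2+2a≤T+2 ∷ _) =
  2a≤T ∷ ≤-trans (*-monoʳ-≤ 2 b≤a) 2a≤T
       ∷ All.tabulate (λ {f} f∈R → pairing-bound a b (total R) (proj₂ f) even 2a≤T b≤a
                                     (All.lookup R≤1+b f∈R) (∈⇒≤total f∈R))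
  where
  2a≤T : 2 * a ≤ a + (b + total R)
  2a≤T = cancel-≤ (2 * a) (a + (b + total R)) 2 2+2a≤T+2
           (solve 1 (λ a → con 2 :* (con 1 :+ a) := con 2 :* a :+ con 2) refl a)
           (solve 3 (λ a b t → (con 1 :+ a) :+ ((con 1 :+ b) :+ t) := (a :+ (b :+ t)) :+ con 2) refl a b (total R))

-- Hakimi: join the two largest requests and recurse.
loopless-realization : ∀ {n} k (R : List (Request n)) → total R ≡ k + k → Unique (vertices R) →
                       Balanced R → LooplessRealization R
loopless-realization zero    R total≡0 _ _ = [] , [] , λ z → sym (total≡0⇒demand≡0 R total≡0 z)
loopless-realization (suc k) R total≡2+2k uniq bal
  with top-two R (subst (0 <_) (sym total≡2+2k) z<s) bal
... | topTwo x y a b R₂ perm b≤a R₂≤1+b = (x , y) ∷ F , within , degrees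
  where
  open ≡-Reasoning
  R′ : List (Request _)
  R′ = (x , a) ∷ (y , b) ∷ R₂
  total′ : total R′ ≡ k + k
  total′ = +-cancelˡ-≡ 2 _ _ (begin
    2 + total R′                ≡⟨ cong suc (+-suc a _) ⟨
    suc a + (suc b + total R₂)  ≡⟨ sum-map-↭ proj₂ perm ⟨
    total R                     ≡⟨ total≡2+2k ⟩
    suc k + suc k               ≡⟨ cong suc (+-suc k k) ⟩
    2 + (k + k)                 ∎)
  vertices↭ : vertices R ↭ vertices R′
  vertices↭ = ↭ₚ.map⁺ proj₁ perm
  unique′ : Unique (vertices R′)
  unique′ = Unique-↭ vertices↭ uniq
  balanced′ : Balanced R′
  balanced′ = balanced-after-pairing R₂ b≤a R₂≤1+b (k , total′)
    (All.map (λ {e} → subst (2 * proj₂ e ≤_) (sum-map-↭ proj₂ perm)) (↭ₚ.All-resp-↭ perm bal))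
  recursive : LooplessRealization R′
  recursive = loopless-realization k R′ total′ unique′ balanced′
  F : List (Edge _)
  F = proj₁ recursive
  back : ∀ {v} → v ∈ vertices R′ → v ∈ vertices R
  back = ↭ₚ.∈-resp-↭ (↭-sym vertices↭)
  within : All (Within (vertices R)) ((x , y) ∷ F)
  within = (All.head (AllPairs.head unique′) , back (here refl) , back (there (here refl)))
         ∷ All.map (Within-⊆ back) (proj₁ (proj₂ recursive))
  degrees : ∀ z → edgeDegree ((x , y) ∷ F) z ≡ demand R z
  degrees z = begin
    δ z x + δ z y + edgeDegree F z
      ≡⟨ cong (δ z x + δ z y +_) (proj₂ (proj₂ recursive) z) ⟩
    δ z x + δ z y + (δ z x * a + (δ z y * b + demand R₂ z))
      ≡⟨ solve 5 (λ X Y a b D → X :+ Y :+ (X :* a :+ (Y :* b :+ D)) := X :* (con 1 :+ a) :+ (Y :* (con 1 :+ b) :+ D))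
               refl (δ z x) (δ z y) a b (demand R₂ z) ⟩
    demand ((x , suc a) ∷ (y , suc b) ∷ R₂) z
      ≡⟨ sum-map-↭ _ perm ⟨
    demand R z ∎

pattern 4+ k = s≤s (s≤s (s≤s (s≤s (z≤n {k}))))

AtLeast4 : ∀ {n} → Request n → Set
AtLeast4 e = 4 ≤ proj₂ e

windmill : ∀ {n} → Fin n → List (Request n) → List (Edge n)
windmill x []                                    = []
windmill x (_ ∷ [])                              = []
windmill x ((a , _) ∷ (b , _) ∷ [])              = (x , a) ∷ (x , b) ∷ (a , b) ∷ []
windmill x ((a , _) ∷ (b , _) ∷ (c , _) ∷ [])    = (x , a) ∷ (x , b) ∷ (a , b) ∷ (x , c) ∷ (b , c) ∷ []
windmill x ((a , _) ∷ (b , _) ∷ c ∷ d ∷ O)       = (x , a) ∷ (x , b) ∷ (a , b) ∷ windmill x (c ∷ d ∷ O)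

leftover : ∀ {n} → List (Request n) → List (Request n)
leftover []                                      = []
leftover (e ∷ [])                                = e ∷ []
leftover ((a , da) ∷ (b , db) ∷ [])              = (a , da ∸ 2) ∷ (b , db ∸ 2) ∷ []
leftover ((a , da) ∷ (b , db) ∷ (c , dc) ∷ [])   = (a , da ∸ 2) ∷ (b , db ∸ 3) ∷ (c , dc ∸ 2) ∷ []
leftover ((a , da) ∷ (b , db) ∷ c ∷ d ∷ O)       = (a , da ∸ 2) ∷ (b , db ∸ 2) ∷ leftover (c ∷ d ∷ O)

-- The parity of length O: the middle vertex of an odd tail spends one more edge.  A single
-- request also counts as odd so that even-length+surplus needs no length hypothesis.
surplus : ∀ {n} → List (Request n) → ℕ
surplus []                  = 0
surplus (_ ∷ [])            = 1
surplus (_ ∷ _ ∷ [])        = 0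
surplus (_ ∷ _ ∷ _ ∷ [])    = 1
surplus (_ ∷ _ ∷ c ∷ d ∷ O) = surplus (c ∷ d ∷ O)

vertices-leftover : ∀ {n} (O : List (Request n)) → vertices (leftover O) ≡ vertices O
vertices-leftover []                      = refl
vertices-leftover (_ ∷ [])                = refl
vertices-leftover (_ ∷ _ ∷ [])            = refl
vertices-leftover (_ ∷ _ ∷ _ ∷ [])        = refl
vertices-leftover ((a , _) ∷ (b , _) ∷ c ∷ d ∷ O) = cong (λ t → a ∷ b ∷ t) (vertices-leftover (c ∷ d ∷ O))

length-leftover : ∀ {n} (O : List (Request n)) → length (leftover O) ≡ length O
length-leftover O = trans (sym (length-map proj₁ (leftover O)))
                          (trans (cong length (vertices-leftover O)) (length-map proj₁ O))

surplus≤1 : ∀ {n} (O : List (Request n)) → surplus O ≤ 1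
surplus≤1 []                  = z≤n
surplus≤1 (_ ∷ [])            = s≤s z≤n
surplus≤1 (_ ∷ _ ∷ [])        = z≤n
surplus≤1 (_ ∷ _ ∷ _ ∷ [])    = s≤s z≤n
surplus≤1 (_ ∷ _ ∷ c ∷ d ∷ O) = surplus≤1 (c ∷ d ∷ O)

even-length+surplus : ∀ {n} (O : List (Request n)) → Even (length O + surplus O)
even-length+surplus []                  = 0 , refl
even-length+surplus (_ ∷ [])            = 1 , refl
even-length+surplus (_ ∷ _ ∷ [])        = 1 , refl
even-length+surplus (_ ∷ _ ∷ _ ∷ [])    = 2 , refl
even-length+surplus (_ ∷ _ ∷ c ∷ d ∷ O) with even-length+surplus (c ∷ d ∷ O)
... | k , e = suc k , cong suc (trans (cong suc e) (sym (+-suc k k)))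

windmill-degree : ∀ {n} (x : Fin n) (O : List (Request n)) → 2 ≤ length O → All AtLeast4 O → ∀ z →
  edgeDegree (windmill x O) z + demand (leftover O) z ≡ δ z x * length O + demand O z
windmill-degree x (_ ∷ []) (s≤s ()) _ z
windmill-degree x ((a , _) ∷ (b , _) ∷ []) _ (4+ ka ∷ 4+ kb ∷ []) z =
  solve 5 (λ X A B ka kb → (X :+ A) :+ ((X :+ B) :+ ((A :+ B) :+ con 0)) :+ (A :* (con 2 :+ ka) :+ (B :* (con 2 :+ kb) :+ con 0))
                         := X :* con 2 :+ (A :* (con 4 :+ ka) :+ (B :* (con 4 :+ kb) :+ con 0)))
          refl (δ z x) (δ z a) (δ z b) ka kb
windmill-degree x ((a , _) ∷ (b , _) ∷ (c , _) ∷ []) _ (4+ ka ∷ 4+ kb ∷ 4+ kc ∷ []) z =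
  solve 7 (λ X A B C ka kb kc → (X :+ A) :+ ((X :+ B) :+ ((A :+ B) :+ ((X :+ C) :+ ((B :+ C) :+ con 0))))
                                   :+ (A :* (con 2 :+ ka) :+ (B :* (con 1 :+ kb) :+ (C :* (con 2 :+ kc) :+ con 0)))
                                := X :* con 3 :+ (A :* (con 4 :+ ka) :+ (B :* (con 4 :+ kb) :+ (C :* (con 4 :+ kc) :+ con 0))))
          refl (δ z x) (δ z a) (δ z b) (δ z c) ka kb kc
windmill-degree x ((a , _) ∷ (b , _) ∷ c ∷ d ∷ O) _ (4+ ka ∷ 4+ kb ∷ rest) z =
  begin
    (X + A) + ((X + B) + ((A + B) + D)) + (A * (2 + ka) + (B * (2 + kb) + V))
      ≡⟨ solve 7 (λ X A B ka kb D V → (X :+ A) :+ ((X :+ B) :+ ((A :+ B) :+ D)) :+ (A :* (con 2 :+ ka) :+ (B :* (con 2 :+ kb) :+ V))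
                                    := (X :+ X :+ A :* (con 4 :+ ka) :+ B :* (con 4 :+ kb)) :+ (D :+ V))
               refl X A B ka kb D V ⟩
    (X + X + A * (4 + ka) + B * (4 + kb)) + (D + V)
      ≡⟨ cong ((X + X + A * (4 + ka) + B * (4 + kb)) +_) (windmill-degree x (c ∷ d ∷ O) (s≤s (s≤s z≤n)) rest z) ⟩
    (X + X + A * (4 + ka) + B * (4 + kb)) + (X * m + W)
      ≡⟨ solve 7 (λ X A B ka kb m W → (X :+ X :+ A :* (con 4 :+ ka) :+ B :* (con 4 :+ kb)) :+ (X :* m :+ W)
                                    := X :* (con 2 :+ m) :+ (A :* (con 4 :+ ka) :+ (B :* (con 4 :+ kb) :+ W)))
               refl X A B ka kb m W ⟩
    X * (2 + m) + (A * (4 + ka) + (B * (4 + kb) + W)) ∎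
  where
  open ≡-Reasoning
  X A B D V m W : ℕ
  X = δ z x
  A = δ z a
  B = δ z b
  D = edgeDegree (windmill x (c ∷ d ∷ O)) z
  V = demand (leftover (c ∷ d ∷ O)) z
  m = length (c ∷ d ∷ O)
  W = demand (c ∷ d ∷ O) z

total-leftover : ∀ {n} (O : List (Request n)) → 2 ≤ length O → All AtLeast4 O →
  total (leftover O) + (2 * length O + surplus O) ≡ total O
total-leftover (_ ∷ []) (s≤s ()) _
total-leftover (_ ∷ _ ∷ []) _ (4+ ka ∷ 4+ kb ∷ []) =
  solve 2 (λ ka kb → (con 2 :+ ka) :+ ((con 2 :+ kb) :+ con 0) :+ (con 2 :* con 2 :+ con 0)
                   := (con 4 :+ ka) :+ ((con 4 :+ kb) :+ con 0)) refl ka kb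
total-leftover (_ ∷ _ ∷ _ ∷ []) _ (4+ ka ∷ 4+ kb ∷ 4+ kc ∷ []) =
  solve 3 (λ ka kb kc → (con 2 :+ ka) :+ ((con 1 :+ kb) :+ ((con 2 :+ kc) :+ con 0)) :+ (con 2 :* con 3 :+ con 1)
                      := (con 4 :+ ka) :+ ((con 4 :+ kb) :+ ((con 4 :+ kc) :+ con 0))) refl ka kb kc
total-leftover (_ ∷ _ ∷ c ∷ d ∷ O) _ (4+ ka ∷ 4+ kb ∷ rest) = begin
  (2 + ka) + ((2 + kb) + S) + (2 * (2 + m) + s)
    ≡⟨ solve 5 (λ ka kb S m s → (con 2 :+ ka) :+ ((con 2 :+ kb) :+ S) :+ (con 2 :* (con 2 :+ m) :+ s)
                              := (con 4 :+ ka) :+ ((con 4 :+ kb) :+ (S :+ (con 2 :* m :+ s))))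
             refl ka kb S m s ⟩
  (4 + ka) + ((4 + kb) + (S + (2 * m + s)))
    ≡⟨ cong (λ t → (4 + ka) + ((4 + kb) + t)) (total-leftover (c ∷ d ∷ O) (s≤s (s≤s z≤n)) rest) ⟩
  (4 + ka) + ((4 + kb) + total (c ∷ d ∷ O)) ∎
  where
  open ≡-Reasoning
  S m s : ℕ
  S = total (leftover (c ∷ d ∷ O))
  m = length (c ∷ d ∷ O)
  s = surplus (c ∷ d ∷ O)

Bounded : ∀ {n} → ℕ → Request n → Set
Bounded h e = 4 ≤ proj₂ e × proj₂ e ≤ h

Residual : ∀ {n} → ℕ → Request n → Set
Residual h e = 1 ≤ proj₂ e × proj₂ e + 2 ≤ h

residual-∸2 : ∀ {h} k → 4 + k ≤ h → 1 ≤ 2 + k × 2 + k + 2 ≤ h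
residual-∸2 {h = h} k le = s≤s z≤n , subst (_≤ h) (+-comm 2 (2 + k)) le

leftover-residual : ∀ {n} h (O : List (Request n)) → 2 ≤ length O → All (Bounded h) O → All (Residual h) (leftover O)
leftover-residual h (_ ∷ []) (s≤s ()) _
leftover-residual h (_ ∷ _ ∷ []) _ ((4+ ka , a≤h) ∷ (4+ kb , b≤h) ∷ []) =
  residual-∸2 {h = h} ka a≤h ∷ residual-∸2 {h = h} kb b≤h ∷ []
leftover-residual h (_ ∷ _ ∷ _ ∷ []) _ ((4+ ka , a≤h) ∷ (4+ kb , b≤h) ∷ (4+ kc , c≤h) ∷ []) =
  residual-∸2 {h = h} ka a≤h
  ∷ (s≤s z≤n , ≤-trans (subst (_≤ 4 + kb) (+-comm 2 (1 + kb)) (n≤1+n _)) b≤h)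
  ∷ residual-∸2 {h = h} kc c≤h ∷ []
leftover-residual h (_ ∷ _ ∷ c ∷ d ∷ O) _ ((4+ ka , a≤h) ∷ (4+ kb , b≤h) ∷ rest) =
  residual-∸2 {h = h} ka a≤h ∷ residual-∸2 {h = h} kb b≤h ∷ leftover-residual h (c ∷ d ∷ O) (s≤s (s≤s z≤n)) rest

HubTriangle : ∀ {n} → List (Edge n) → Fin n → Fin n → Set
HubTriangle {n} E x o = Joined E x o × ∃ λ p → Joined E o p × Joined E x p

HubTriangle-∷ : ∀ {n} {E : List (Edge n)} {e x o} → HubTriangle E x o → HubTriangle (e ∷ E) x o
HubTriangle-∷ (xo , p , op , xp) = Joined-∷ xo , p , Joined-∷ op , Joined-∷ xp

HubTriangle-++⁺ˡ : ∀ {n} {E : List (Edge n)} F {x o} → HubTriangle E x o → HubTriangle (E ++ F) x o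
HubTriangle-++⁺ˡ F (xo , p , op , xp) = Joined-++⁺ˡ F xo , p , Joined-++⁺ˡ F op , Joined-++⁺ˡ F xp

windmill-spokes : ∀ {n} (x : Fin n) (O : List (Request n)) → 2 ≤ length O →
                  ∀ {o} → o ∈ vertices O → HubTriangle (windmill x O) x o
windmill-spokes x (_ ∷ []) (s≤s ()) _
windmill-spokes x ((a , _) ∷ (b , _) ∷ []) _ (here refl) =
  inj₁ (here refl) , b , inj₁ (there (there (here refl))) , inj₁ (there (here refl))
windmill-spokes x ((a , _) ∷ (b , _) ∷ []) _ (there (here refl)) =
  inj₁ (there (here refl)) , a , inj₂ (there (there (here refl))) , inj₁ (here refl)
windmill-spokes x ((a , _) ∷ (b , _) ∷ (c , _) ∷ []) _ (here refl) =
  inj₁ (here refl) , b , inj₁ (there (there (here refl))) , inj₁ (there (here refl))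
windmill-spokes x ((a , _) ∷ (b , _) ∷ (c , _) ∷ []) _ (there (here refl)) =
  inj₁ (there (here refl)) , a , inj₂ (there (there (here refl))) , inj₁ (here refl)
windmill-spokes x ((a , _) ∷ (b , _) ∷ (c , _) ∷ []) _ (there (there (here refl))) =
  inj₁ (there (there (there (here refl)))) , b , inj₂ (there (there (there (there (here refl))))) , inj₁ (there (here refl))
windmill-spokes x ((a , _) ∷ (b , _) ∷ c ∷ d ∷ O) _ (here refl) =
  inj₁ (here refl) , b , inj₁ (there (there (here refl))) , inj₁ (there (here refl))
windmill-spokes x ((a , _) ∷ (b , _) ∷ c ∷ d ∷ O) _ (there (here refl)) =
  inj₁ (there (here refl)) , a , inj₂ (there (there (here refl))) , inj₁ (here refl)
windmill-spokes x ((a , _) ∷ (b , _) ∷ c ∷ d ∷ O) _ (there (there o∈O)) =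
  HubTriangle-∷ (HubTriangle-∷ (HubTriangle-∷ (windmill-spokes x (c ∷ d ∷ O) (s≤s (s≤s z≤n)) o∈O)))

windmill-within : ∀ {n} (x : Fin n) (O : List (Request n)) → Unique (x ∷ vertices O) →
                  All (Within (x ∷ vertices O)) (windmill x O)
windmill-within x [] _ = []
windmill-within x (_ ∷ []) _ = []
windmill-within x ((a , _) ∷ (b , _) ∷ []) ((x≢a ∷ x≢b ∷ []) ∷ (a≢b ∷ []) ∷ _) =
    (x≢a , here refl , there (here refl))
  ∷ (x≢b , here refl , there (there (here refl)))
  ∷ (a≢b , there (here refl) , there (there (here refl))) ∷ []
windmill-within x ((a , _) ∷ (b , _) ∷ (c , _) ∷ [])
                ((x≢a ∷ x≢b ∷ x≢c ∷ []) ∷ (a≢b ∷ _ ∷ []) ∷ (b≢c ∷ []) ∷ _) =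
    (x≢a , here refl , there (here refl))
  ∷ (x≢b , here refl , there (there (here refl)))
  ∷ (a≢b , there (here refl) , there (there (here refl)))
  ∷ (x≢c , here refl , there (there (there (here refl))))
  ∷ (b≢c , there (there (here refl)) , there (there (there (here refl)))) ∷ []
windmill-within x ((a , _) ∷ (b , _) ∷ c ∷ d ∷ O) ((x≢a ∷ x≢b ∷ x∉O) ∷ (a≢b ∷ _) ∷ _ ∷ uniqueO) =
    (x≢a , here refl , there (here refl))
  ∷ (x≢b , here refl , there (there (here refl)))
  ∷ (a≢b , there (here refl) , there (there (here refl)))
  ∷ All.map (Within-⊆ skip) (windmill-within x (c ∷ d ∷ O) (x∉O ∷ uniqueO))
  where
  skip : ∀ {v} → v ∈ x ∷ vertices (c ∷ d ∷ O) → v ∈ x ∷ a ∷ b ∷ vertices (c ∷ d ∷ O)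
  skip (here v≡x)   = here v≡x
  skip (there v∈O)  = there (there (there v∈O))

triangulated-hub : ∀ {n} (E : List (Edge n)) x N → All (Within (x ∷ N)) E →
                   (∀ {o} → o ∈ N → HubTriangle E x o) → Triangulated E
triangulated-hub E x N within spokes = All.map inTriangle within
  where
  inTriangle : ∀ {e} → Within (x ∷ N) e → InTriangle E e
  inTriangle (u≢v , here refl , here refl) = ⊥-elim (u≢v refl)
  inTriangle (u≢v , here refl , there v∈N) with spokes v∈N
  ... | _ , p , vp , xp = u≢v , p , xp , vp
  inTriangle (u≢v , there u∈N , here refl) with spokes u∈N
  ... | _ , p , up , xp = u≢v , p , up , xp
  inTriangle (u≢v , there u∈N , there v∈N) =
    u≢v , x , Joined-sym (proj₁ (spokes u∈N)) , Joined-sym (proj₁ (spokes v∈N))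

*-length≤total : ∀ {n} c (L : List (Request n)) → All (λ f → c ≤ proj₂ f) L → c * length L ≤ total L
*-length≤total c []            []         = ≤-reflexive (*-zeroʳ c)
*-length≤total c ((y , r) ∷ L) (c≤r ∷ cs) =
  subst (_≤ r + total L) (sym (*-suc c (length L))) (+-mono-≤ c≤r (*-length≤total c L cs))

∈⇒+*length≤total : ∀ {n} c {e : Request n} (L : List (Request n)) → e ∈ L → All (λ f → c ≤ proj₂ f) L →
                   proj₂ e + c * length L ≤ total L + c
∈⇒+*length≤total c {e} ((y , r) ∷ L) e∈ (c≤r ∷ cs) = begin
  proj₂ e + c * suc (length L)
    ≡⟨ solve 3 (λ e c l → e :+ c :* (con 1 :+ l) := e :+ c :* l :+ c) refl (proj₂ e) c (length L) ⟩
  proj₂ e + c * length L + c    ≤⟨ step e∈ ⟩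
  r + total L + c               ∎
  where
  open ≤-Reasoning
  step : ∀ {e} → e ∈ (y , r) ∷ L → proj₂ e + c * length L + c ≤ r + total L + c
  step (here refl)  = +-monoˡ-≤ c (+-monoʳ-≤ r (*-length≤total c L cs))
  step {e} (there e∈L) = begin
    proj₂ e + c * length L + c  ≤⟨ +-monoˡ-≤ c (∈⇒+*length≤total c L e∈L cs) ⟩
    total L + c + c             ≤⟨ +-monoʳ-≤ (total L + c) c≤r ⟩
    total L + c + r             ≡⟨ solve 3 (λ t c r → t :+ c :+ r := r :+ t :+ c) refl (total L) c r ⟩
    r + total L + c             ∎

parity-slack : ∀ {h m s T} → h + m ≤ T → Even (h + T) → Even (m + s) → s ≤ 1 → h + m + s ≤ T
parity-slack {h} {m} {zero}  {T} h+m≤T _ _ _ = subst (_≤ T) (sym (+-identityʳ (h + m))) h+m≤T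
parity-slack {h} {m} {suc zero} {T} h+m≤T even-h+T even-m+1 _ with m≤n⇒m<n∨m≡n h+m≤T
... | inj₁ h+m<T = subst (_≤ T) (+-comm 1 (h + m)) h+m<T
... | inj₂ refl  = ⊥-elim (even⇒¬odd even-h+T (subst Odd (+-assoc h h m) (even+odd (h , refl) odd-m)))
  where
  odd-m : Odd m
  odd-m = odd-+⁻ʳ (subst Even (+-comm m 1) even-m+1) (0 , refl)
parity-slack {s = suc (suc _)} _ _ _ (s≤s ())

residual-balanced : ∀ {f u m S} → f + 2 ≤ u + m → f + m ≤ S + 1 → 2 * f ≤ u + S
residual-balanced {f} {u} {m} {S} f+2≤u+m f+m≤S+1 = ≤-trans (n≤1+n _)
  (cancel-≤ (suc (2 * f)) (u + S) (m + 1) (+-mono-≤ f+2≤u+m f+m≤S+1)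
    (solve 2 (λ f m → (f :+ con 2) :+ (f :+ m) := (con 1 :+ con 2 :* f) :+ (m :+ con 1)) refl f m)
    (solve 3 (λ u m S → (u :+ m) :+ (S :+ con 1) := (u :+ S) :+ (m :+ con 1)) refl u m S))

residual-realization : ∀ {n} (x : Fin n) h (O : List (Request n)) → Unique (x ∷ vertices O) →
  All (Bounded h) O → 2 ≤ length O → length O ≤ h → h + length O ≤ total O → Even (h + total O) →
  LooplessRealization ((x , h ∸ length O) ∷ leftover O)
residual-realization {n} x h O unique bounded 2≤m m≤h h+m≤T even =
  loopless-realization (proj₁ even-R) R (proj₂ even-R) unique-R balanced-R
  where
  m u s S : ℕ
  m = length O
  u = h ∸ m
  s = surplus O
  S = total (leftover O)
  u+m≡h : u + m ≡ h
  u+m≡h = m∸n+n≡m m≤h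
  S+2m+s≡T : S + (2 * m + s) ≡ total O
  S+2m+s≡T = total-leftover O 2≤m (All.map proj₁ bounded)
  R : List (Request n)
  R = (x , u) ∷ leftover O
  even-R : Even (total R)
  even-R = even-+⁻ʳ (subst Even h+T≡ even) (even+even (m , refl) (even-length+surplus O))
    where
    h+T≡ : h + total O ≡ (m + m + (m + s)) + total R
    h+T≡ = trans (cong₂ _+_ (sym u+m≡h) (sym S+2m+s≡T))
                 (solve 4 (λ u m S s → (u :+ m) :+ (S :+ (con 2 :* m :+ s)) := (m :+ m :+ (m :+ s)) :+ (u :+ S)) refl u m S s)
  u≤S : u ≤ S
  u≤S = cancel-≤ u S (2 * m + s) (parity-slack h+m≤T even (even-length+surplus O) (surplus≤1 O))
          (trans (cong (λ t → t + m + s) (sym u+m≡h))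
                 (solve 3 (λ u m s → (u :+ m) :+ m :+ s := u :+ (con 2 :* m :+ s)) refl u m s))
          (sym S+2m+s≡T)
  residual : All (Residual h) (leftover O)
  residual = leftover-residual h O 2≤m bounded
  balanced-R : Balanced R
  balanced-R = subst (_≤ u + S) (cong (u +_) (sym (+-identityʳ u))) (+-monoʳ-≤ u u≤S)
             ∷ All.tabulate (λ {f} f∈ → residual-balanced
                 (subst (λ t → proj₂ f + 2 ≤ t) (sym u+m≡h) (proj₂ (All.lookup residual f∈)))
                 (subst (λ t → proj₂ f + t ≤ S + 1) (trans (*-identityˡ _) (length-leftover O))
                    (∈⇒+*length≤total 1 (leftover O) f∈ (All.map proj₁ residual))))
  unique-R : Unique (vertices R)
  unique-R = subst (λ N → Unique (x ∷ N)) (sym (vertices-leftover O)) unique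

hub-realization : ∀ {n} (x : Fin n) h (O : List (Request n)) → Unique (x ∷ vertices O) → All (Bounded h) O →
                  2 ≤ length O → length O ≤ h → h + length O ≤ total O → Even (h + total O) →
                  Realization ((x , h) ∷ O)
hub-realization {n} x h O unique bounded 2≤m m≤h h+m≤T even = windmill x O ++ F , triangulated , degrees
  where
  rest : LooplessRealization ((x , h ∸ length O) ∷ leftover O)
  rest = residual-realization x h O unique bounded 2≤m m≤h h+m≤T even
  F : List (Edge n)
  F = proj₁ rest
  triangulated : Triangulated (windmill x O ++ F)
  triangulated = triangulated-hub (windmill x O ++ F) x (vertices O)
    (Allₚ.++⁺ (windmill-within x O unique)
              (subst (λ N → All (Within (x ∷ N)) F) (vertices-leftover O) (proj₁ (proj₂ rest))))
    (λ o∈ → HubTriangle-++⁺ˡ F (windmill-spokes x O 2≤m o∈))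
  degrees : ∀ z → edgeDegree (windmill x O ++ F) z ≡ demand ((x , h) ∷ O) z
  degrees z = begin
    edgeDegree (windmill x O ++ F) z
      ≡⟨ sum-map-++ _ (windmill x O) F ⟩
    W + edgeDegree F z
      ≡⟨ cong (W +_) (proj₂ (proj₂ rest) z) ⟩
    W + (X * u + demand (leftover O) z)
      ≡⟨ solve 3 (λ W Xu L → W :+ (Xu :+ L) := Xu :+ (W :+ L)) refl W (X * u) (demand (leftover O) z) ⟩
    X * u + (W + demand (leftover O) z)
      ≡⟨ cong (X * u +_) (windmill-degree x O 2≤m (All.map proj₁ bounded) z) ⟩
    X * u + (X * m + demand O z)
      ≡⟨ solve 4 (λ X u m D → X :* u :+ (X :* m :+ D) := X :* (u :+ m) :+ D) refl X u m (demand O z) ⟩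
    X * (u + m) + demand O z
      ≡⟨ cong (λ t → X * t + demand O z) (m∸n+n≡m m≤h) ⟩
    X * h + demand O z ∎
    where
    open ≡-Reasoning
    X W m u : ℕ
    X = δ z x
    W = edgeDegree (windmill x O) z
    m = length O
    u = h ∸ m

hub-long : ∀ {h} a → 4 ≤ h → h ≤ 3 * a → 2 ≤ a
hub-long zero          4≤h h≤0 with ≤-trans 4≤h h≤0
... | ()
hub-long (suc zero)    4≤h h≤3 with ≤-trans 4≤h h≤3
... | s≤s (s≤s (s≤s ()))
hub-long (suc (suc a)) _   _   = s≤s (s≤s z≤n)

3a≤2h⇒a≤h : ∀ {a h} → 3 * a ≤ 2 * h → a ≤ h
3a≤2h⇒a≤h {a} {h} 3a≤2h = *-cancelˡ-≤ 3 (≤-trans 3a≤2h (*-monoˡ-≤ h (n≤1+n 2)))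

hub-total : ∀ {h a T} → h ≤ 3 * a → 4 * a ≤ T → h + a ≤ T
hub-total {h} {a} {T} h≤3a 4a≤T =
  ≤-trans (+-monoˡ-≤ a h≤3a) (subst (_≤ T) (solve 1 (λ a → con 4 :* a := con 3 :* a :+ a) refl a) 4a≤T)

rest-room : ∀ {h a c} → h < a + c → 3 * a ≤ 2 * h → h + 3 ≤ 3 * c
rest-room {h} {a} {c} h<a+c 3a≤2h =
  cancel-≤ (h + 3) (3 * c) (3 * a + 2 * h) (+-mono-≤ (*-monoʳ-≤ 3 h<a+c) 3a≤2h)
    (solve 2 (λ h a → con 3 :* (con 1 :+ h) :+ con 3 :* a := (h :+ con 3) :+ (con 3 :* a :+ con 2 :* h)) refl h a)
    (solve 3 (λ h a c → con 3 :* (a :+ c) :+ con 2 :* h := con 3 :* c :+ (con 3 :* a :+ con 2 :* h)) refl h a c)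

rest-long : ∀ {h c} → 4 ≤ h → h + 3 ≤ 3 * c → 3 ≤ c
rest-long 4≤h h+3≤3c =
  ≮⇒≥ (λ c<3 → ≤⇒≯ (*-monoʳ-≤ 3 (≤-pred c<3)) (≤-trans (+-monoˡ-≤ 3 4≤h) h+3≤3c))

rest-bounded : ∀ {f c h S} → f + 4 * c ≤ S + 4 → f ≤ h → h + 3 ≤ 3 * c → 2 * f + c ≤ suc S
rest-bounded {f} {c} {h} {S} f+4c≤S+4 f≤h h+3≤3c =
  cancel-≤ (2 * f + c) (suc S) (3 * c + h + 3) (+-mono-≤ (+-mono-≤ f+4c≤S+4 f≤h) h+3≤3c)
    (solve 3 (λ f c h → f :+ con 4 :* c :+ f :+ (h :+ con 3) := (con 2 :* f :+ c) :+ (con 3 :* c :+ h :+ con 3)) refl f c h)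
    (solve 3 (λ S h c → S :+ con 4 :+ h :+ con 3 :* c := (con 1 :+ S) :+ (con 3 :* c :+ h :+ con 3)) refl S h c)

-- q partners of a hub of degree h: enough to absorb h, few enough that the other vertices stay
-- admissible; room allows one extra partner when parity requires it.
record HubShare (h q : ℕ) : Set where
  field
    h≤3q  : h ≤ 3 * q
    3q≤2h : 3 * q ≤ 2 * h
    room  : 5 ≤ h → 3 * suc q ≤ 2 * h

3q≤2h⇒3[2+q]≤2[3+h] : ∀ {q h} → 3 * q ≤ 2 * h → 3 * suc (suc q) ≤ 2 * (3 + h)
3q≤2h⇒3[2+q]≤2[3+h] {q} {h} 3q≤2h = subst₂ _≤_
  (solve 1 (λ q → con 6 :+ con 3 :* q := con 3 :* (con 2 :+ q)) refl q)
  (solve 1 (λ h → con 6 :+ con 2 :* h := con 2 :* (con 3 :+ h)) refl h)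
  (+-monoʳ-≤ 6 3q≤2h)

hub-share-4+ : ∀ k → ∃ (HubShare (4 + k))
hub-share-4+ 0 = 2 , record { h≤3q = m≤m+n 4 2 ; 3q≤2h = m≤m+n 6 2 ; room = λ 5≤4 → ⊥-elim (<-irrefl refl 5≤4) }
hub-share-4+ 1 = 2 , record { h≤3q = m≤m+n 5 1 ; 3q≤2h = m≤m+n 6 4 ; room = λ _ → m≤m+n 9 1 }
hub-share-4+ 2 = 2 , record { h≤3q = ≤-refl    ; 3q≤2h = m≤m+n 6 6 ; room = λ _ → m≤m+n 9 3 }
hub-share-4+ (suc (suc (suc k))) with hub-share-4+ k
... | q , share = suc q , record
  { h≤3q  = subst (7 + k ≤_) (sym (*-suc 3 q)) (+-monoʳ-≤ 3 h≤3q)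
  ; 3q≤2h = ≤-trans (*-monoʳ-≤ 3 (n≤1+n (suc q))) (3q≤2h⇒3[2+q]≤2[3+h] {q} {4 + k} 3q≤2h)
  ; room  = λ _ → 3q≤2h⇒3[2+q]≤2[3+h] {q} {4 + k} 3q≤2h
  }
  where open HubShare share

hub-share : ∀ {h} → 4 ≤ h → ∃ (HubShare h)
hub-share (4+ k) = hub-share-4+ k

record Admissible {n} (L : List (Request n)) : Set where
  field
    long     : 3 ≤ length L
    atLeast4 : All AtLeast4 L
    even     : Even (total L)
    unique   : Unique (vertices L)
    -- condition (iii) for every request d: d ≤ Σ over the other requests of (d′ − 1)
    bounded  : All (λ e → 2 * proj₂ e + length L ≤ suc (total L)) L

admissible-↭ : ∀ {n} {L L′ : List (Request n)} → L ↭ L′ → Admissible L → Admissible L′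
admissible-↭ {L = L} {L′} L↭L′ adm = record
  { long     = subst (3 ≤_) length≡ long
  ; atLeast4 = ↭ₚ.All-resp-↭ L↭L′ atLeast4
  ; even     = subst Even total≡ even
  ; unique   = Unique-↭ (↭ₚ.map⁺ proj₁ L↭L′) unique
  ; bounded  = All.map (subst₂ (λ l t → _ + l ≤ suc t) length≡ total≡) (↭ₚ.All-resp-↭ L↭L′ bounded)
  }
  where
  open Admissible adm
  length≡ : length L ≡ length L′
  length≡ = ↭ₚ.↭-length L↭L′
  total≡ : total L ≡ total L′
  total≡ = sum-map-↭ proj₂ L↭L′

odd-member : ∀ {n} (C : List (Request n)) → Odd (total C) →
             ∃ λ u → ∃ λ C′ → (C ↭ u ∷ C′) × Odd (proj₂ u)
odd-member ((y , v) ∷ C) odd with even⊎odd v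
... | inj₂ odd-v  = (y , v) , C , ↭-refl , odd-v
... | inj₁ even-v with even⊎odd (total C)
...   | inj₁ even-C = ⊥-elim (even⇒¬odd (even+even even-v even-C) odd)
...   | inj₂ odd-C with odd-member C odd-C
...     | u , C′ , C↭ , odd-u = u , (y , v) ∷ C′ , ↭-trans (prep (y , v) C↭) (swap (y , v) u ↭-refl) , odd-u

4≤odd⇒5≤ : ∀ {v} → 4 ≤ v → Odd v → 5 ≤ v
4≤odd⇒5≤ 4≤v odd with m≤n⇒m<n∨m≡n 4≤v
... | inj₁ 4<v = 4<v
... | inj₂ refl = ⊥-elim (even⇒¬odd (2 , refl) odd)

hub-and-rest : ∀ {n} (x : Fin n) h (A C : List (Request n)) → (Admissible C → Realization C) →
  Unique (x ∷ vertices (A ++ C)) → All (Bounded h) (A ++ C) → Even (h + total (A ++ C)) → Even (h + total A) →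
  4 ≤ h → h ≤ 3 * length A → 3 * length A ≤ 2 * h → h < length A + length C →
  Realization ((x , h) ∷ A ++ C)
hub-and-rest x h A C realize-C unique bounded even even-A 4≤h h≤3a 3a≤2h h<a+c
  with subst (λ N → Unique (x ∷ N)) (map-++ proj₁ A C) unique
... | x∉A++C ∷ unique-A++C = realization-++ {A = (x , h) ∷ A} hub (realize-C admissible-C)
  where
  bounded-A : All (Bounded h) A
  bounded-A = Allₚ.++⁻ˡ A bounded
  bounded-C : All (Bounded h) C
  bounded-C = Allₚ.++⁻ʳ A bounded
  hub : Realization ((x , h) ∷ A)
  hub = hub-realization x h A
          (Allₚ.++⁻ˡ (vertices A) x∉A++C ∷ proj₁ (Unique-++⁻ (vertices A) unique-A++C)) bounded-A
          (hub-long (length A) 4≤h h≤3a) (3a≤2h⇒a≤h 3a≤2h)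
          (hub-total h≤3a (*-length≤total 4 A (All.map proj₁ bounded-A))) even-A
  h+3≤3c : h + 3 ≤ 3 * length C
  h+3≤3c = rest-room {h} {length A} {length C} h<a+c 3a≤2h
  admissible-C : Admissible C
  admissible-C = record
    { long     = rest-long 4≤h h+3≤3c
    ; atLeast4 = All.map proj₁ bounded-C
    ; even     = even-+⁻ʳ (subst Even (trans (cong (h +_) (sum-map-++ proj₂ A C)) (sym (+-assoc h _ _))) even) even-A
    ; unique   = proj₂ (Unique-++⁻ (vertices A) unique-A++C)
    ; bounded  = All.tabulate (λ f∈ → rest-bounded (∈⇒+*length≤total 4 C f∈ (All.map proj₁ bounded-C))
                                                   (proj₂ (All.lookup bounded-C f∈)) h+3≤3c)
    }

-- If h + total A is odd, moving an odd request from C into A repairs the parity.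
realization-split : ∀ {n} (x : Fin n) h (A C : List (Request n)) →
  (∀ C′ → length C′ ≤ length C → Admissible C′ → Realization C′) →
  Unique (x ∷ vertices (A ++ C)) → All (Bounded h) (A ++ C) → Even (h + total (A ++ C)) →
  4 ≤ h → HubShare h (length A) → h < length A + length C → Realization ((x , h) ∷ A ++ C)
realization-split x h A C realize unique bounded even 4≤h share h<a+c with even⊎odd (h + total A)
... | inj₁ even-A = hub-and-rest x h A C (realize C ≤-refl) unique bounded even even-A 4≤h h≤3q 3q≤2h h<a+c
  where open HubShare share
... | inj₂ odd-A with odd-member C (odd-+⁻ʳ (subst Even h+T≡ even) odd-A)
  where
  h+T≡ : h + total (A ++ C) ≡ (h + total A) + total C
  h+T≡ = trans (cong (h +_) (sum-map-++ proj₂ A C)) (sym (+-assoc h _ _))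
...   | u , C′ , C↭ , odd-u = realization-↭ (prep (x , h) A++C↭)
          (hub-and-rest x h (u ∷ A) C′ (realize C′ |C′|≤|C|)
            (Unique-↭ (↭ₚ.map⁺ proj₁ (prep (x , h) A++C↭)) unique)
            (↭ₚ.All-resp-↭ A++C↭ bounded)
            (subst (λ t → Even (h + t)) (sum-map-↭ proj₂ A++C↭) even)
            (subst Even (solve 3 (λ h t u → (h :+ t) :+ u := h :+ (u :+ t)) refl h (total A) (proj₂ u)) (odd+odd odd-A odd-u))
            4≤h (≤-trans h≤3q (*-monoʳ-≤ 3 (n≤1+n _))) (room 5≤h)
            (subst (h <_) (trans (cong (length A +_) |C|≡1+|C′|) (+-suc (length A) (length C′))) h<a+c))
  where
  open HubShare share
  A++C↭ : A ++ C ↭ u ∷ A ++ C′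
  A++C↭ = ↭-trans (↭ₚ.++⁺ˡ A C↭) (↭ₚ.shift u A C′)
  |C|≡1+|C′| : length C ≡ suc (length C′)
  |C|≡1+|C′| = ↭ₚ.↭-length C↭
  |C′|≤|C| : length C′ ≤ length C
  |C′|≤|C| = ≤-trans (n≤1+n _) (≤-reflexive (sym |C|≡1+|C′|))
  5≤h : 5 ≤ h
  5≤h with All.lookup (Allₚ.++⁻ʳ A bounded) (↭ₚ.∈-resp-↭ (↭-sym C↭) (here refl))
  ... | 4≤u , u≤h = ≤-trans (4≤odd⇒5≤ 4≤u odd-u) u≤h

bounded-by-max : ∀ {n} {x : Fin n} {h O} → Admissible ((x , h) ∷ O) → All (λ f → proj₂ f ≤ h) O → All (Bounded h) O
bounded-by-max adm O≤h = All.zipWith (λ (4≤f , f≤h) → 4≤f , f≤h) (All.tail (Admissible.atLeast4 adm) , O≤h)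

split-at : ∀ {A : Set} q (xs : List A) → q ≤ length xs → ∃ λ ys → ∃ λ zs → xs ≡ ys ++ zs × length ys ≡ q
split-at q xs q≤ = take q xs , drop q xs , sym (take++drop≡id q xs) , trans (length-take q xs) (m≤n⇒m⊓n≡m q≤)

realization-large : ∀ {n} (x : Fin n) h (O : List (Request n)) →
  (∀ C → length C ≤ length O → Admissible C → Realization C) →
  Unique (x ∷ vertices O) → All (Bounded h) O → Even (h + total O) → 4 ≤ h → h < length O →
  Realization ((x , h) ∷ O)
realization-large x h O realize unique bounded even 4≤h h<m with hub-share 4≤h
... | q , share with split-at q O (≤-trans (3a≤2h⇒a≤h (HubShare.3q≤2h share)) (<⇒≤ h<m))
...   | A , C , refl , refl =
  realization-split x h A C
    (λ C′ le → realize C′ (≤-trans le (subst (length C ≤_) (sym (length-++ A)) (m≤n+m (length C) (length A)))))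
    unique bounded even 4≤h share (subst (h <_) (length-++ A) h<m)

max-room : ∀ {h m T} → 2 * h + suc m ≤ suc (h + T) → h + m ≤ T
max-room {h} {m} {T} le = cancel-≤ (h + m) T (h + 1) le
  (solve 2 (λ h m → con 2 :* h :+ (con 1 :+ m) := (h :+ m) :+ (h :+ con 1)) refl h m)
  (solve 2 (λ h T → con 1 :+ (h :+ T) := T :+ (h :+ con 1)) refl h T)

realization-max : ∀ {n} (x : Fin n) h (O : List (Request n)) →
  (∀ C → length C ≤ length O → Admissible C → Realization C) →
  Admissible ((x , h) ∷ O) → All (λ f → proj₂ f ≤ h) O → Realization ((x , h) ∷ O)
realization-max x h O realize adm O≤h with length O ≤? h
... | yes m≤h = hub-realization x h O unique (bounded-by-max adm O≤h) (≤-pred long) m≤h (max-room (All.head bounded)) even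
  where open Admissible adm
... | no  m≰h = realization-large x h O realize unique (bounded-by-max adm O≤h) even (All.head atLeast4) (≰⇒> m≰h)
  where open Admissible adm

realization-≤ : ∀ {n} f (L : List (Request n)) → length L ≤ f → Admissible L → Realization L
realization-≤ f [] _ adm with Admissible.long adm
... | ()
realization-≤ (suc f) (e ∷ L) (s≤s |L|≤f) adm with extract-max e L
... | (x , h) , O , perm , O≤h = realization-↭ perm
  (realization-max x h O (λ C |C|≤|O| → realization-≤ f C (≤-trans |C|≤|O| |O|≤f)) (admissible-↭ perm adm) O≤h)
  where
  |O|≤f : length O ≤ f
  |O|≤f = subst (_≤ f) (suc-injective (↭ₚ.↭-length perm)) |L|≤f

realization : ∀ {n} (L : List (Request n)) → Admissible L → Realization L
realization L = realization-≤ (length L) L ≤-refl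

requests : ∀ {n} → (Fin n → ℕ) → List (Request n)
requests d = tabulate (λ i → i , d i)

total-requests : ∀ {n} (d : Fin n → ℕ) → total (requests d) ≡ ∑ d
total-requests d = trans (cong sum (map-tabulate (λ i → i , d i) proj₂)) (sum-tabulate d)

demand-requests : ∀ {n} (d : Fin n → ℕ) z → demand (requests d) z ≡ d z
demand-requests d z = begin
  demand (requests d) z              ≡⟨ cong sum (map-tabulate (λ i → i , d i) (λ e → δ z (proj₁ e) * proj₂ e)) ⟩
  sum (tabulate (λ i → δ z i * d i)) ≡⟨ sum-tabulate (λ i → δ z i * d i) ⟩
  ∑ (λ i → δ z i * d i)              ≡⟨ ∑-δ* z d ⟩
  d z                                ∎
  where open ≡-Reasoning

unique-requests : ∀ {n} (d : Fin n → ℕ) → Unique (vertices (requests d))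
unique-requests {n} d = subst Unique (sym (map-tabulate (λ i → i , d i) proj₁)) (Uniqueₚ.allFin⁺ n)

largest-bounded : ∀ {a b m S} → a ≤ b → b + m ≤ S → 2 * a + suc m ≤ suc (b + S)
largest-bounded {a} {b} {m} {S} a≤b b+m≤S = begin
  2 * a + suc m    ≤⟨ +-monoˡ-≤ (suc m) (*-monoʳ-≤ 2 a≤b) ⟩
  2 * b + suc m    ≡⟨ solve 2 (λ b m → con 2 :* b :+ (con 1 :+ m) := con 1 :+ (b :+ (b :+ m))) refl b m ⟩
  suc (b + (b + m)) ≤⟨ s≤s (+-monoʳ-≤ b b+m≤S) ⟩
  suc (b + S)      ∎
  where open ≤-Reasoning

admissible-requests : ∀ m (d : Fin (suc m) → ℕ) → 3 ≤ suc m → (∀ i j → i Data.Fin.≤ j → d j ≤ d i) →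
  (∀ i → 4 ≤ d i) → Even (∑ d) → d zero ≤ ∑ (λ (i : Fin m) → d (suc i) ∸ 1) → Admissible (requests d)
admissible-requests m d 3≤n sorted 4≤d even d₀≤ = record
  { long     = subst (3 ≤_) (sym length≡) 3≤n
  ; atLeast4 = Allₚ.tabulate⁺ {f = λ i → i , d i} 4≤d
  ; even     = subst Even (sym (total-requests d)) even
  ; unique   = unique-requests d
  ; bounded  = Allₚ.tabulate⁺ {f = λ i → i , d i} (λ i →
                 subst₂ (λ l t → 2 * d i + l ≤ suc t) (sym length≡) (sym (total-requests d))
                        (largest-bounded (sorted zero i z≤n) tail-room))
  }
  where
  length≡ : length (requests d) ≡ suc m
  length≡ = length-tabulate (λ i → i , d i)
  tail-room : d zero + m ≤ ∑ (λ i → d (suc i))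
  tail-room = subst (d zero + m ≤_) (∑-∸1 (λ i → d (suc i)) (λ i → ≤-trans (s≤s z≤n) (4≤d (suc i))))
                    (+-monoˡ-≤ m d₀≤)

theorem1p5 : (m : ℕ) → suc m ≥ 3 → (d : Fin (suc m) → ℕ)
    → (∀ i j → i Data.Fin.≤ j → d j Data.Nat.≤ d i)
    → (∀ i → d i ≥ 4)
    → Even (∑ d)
    → d zero Data.Nat.≤ ∑ (λ (i : Fin m) → d (suc i) ∸ 1)
    → Σ (Multigraph (suc m)) λ G → Triangular G × (∀ i → deg G i ≡ d i)
theorem1p5 m 3≤n d sorted 4≤d even d₀≤
  with realization (requests d) (admissible-requests m d 3≤n sorted 4≤d even d₀≤)
... | E , triangulated , degrees =
  toMultigraph E (All.map proj₁ triangulated) , toMultigraph-triangular E triangulated ,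
  λ i → trans (∑-multiplicity E i) (trans (degrees i) (demand-requests d i))
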